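{- Let $k\geq 2$. For $n\geq 2k+1$, $\mathrm{lk}(\{n-1,n\}, D(n,2k-1))=\partial C(n-2,2k-2)$, and for $n\geq 2k+2$, $\mathrm{lk}(\{n-2,n-1,n\}, D(n,2k))=\partial C(n-3,2k-2)$.
   Context: For $m\ge d+1$, $\partial C(m,d)$ denotes the boundary complex of the cyclic $d$-polytope with vertices labeled $1,\dots,m$ along the moment curve; equivalently, it is the simplicial complex on $[m]$ whose facets are the $d$-subsets $S\subseteq[m]$ such that any two elements of $[m]\setminus S$ are separated by an even number of elements of $S$ (Gale's evenness condition). For $J=(j_1,\dots,j_r)$ with all $j_i\ge2$ and sum $d+1$, and $n>d$, $\Gamma^J_n$ is the pure $d$-dimensional complex on $[n]$ generated by all sets $I_1\cup\dots\cup I_r$ with $I_1,\dots,I_r$ pairwise disjoint intervals of consecutive integers in $[n]$ of sizes $j_1,\dots,j_r$, each $I_i$ entirely to the left of $I_{i+1}$; it is a PL $d$-ball. For $d\ge4$ and $n>d$, let $J=(2,\dots,2,3)$ if $d$ is even and $J=(2,\dots,2,4)$ if $d$ is odd (entries summing to $d+1$), and define $D(n,d-1)$ to be the boundary complex of $\Gamma^J_n$ (the complex generated by the $(d-1)$-faces of $\Gamma^J_n$ lying in exactly one facet). The link is $\mathrm{lk}(F,\Delta)=\{G\in\Delta: G\cap F=\emptyset,\ G\cup F\in\Delta\}$. -}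

module Defs where

open import Data.Nat using (ℕ; zero; suc; _+_; _*_; _∸_; _≤_; _<_; _<?_)
open import Data.Nat.DivMod using (_/_; _%_)
open import Data.Nat.Divisibility using (_∣_)
open import Data.List using (List; []; _∷_; _++_; length; filter; replicate; applyUpTo)
open import Data.List.Membership.Propositional using (_∈_)
open import Data.List.Relation.Unary.Linked using (Linked)
open import Data.Product using (Σ; ∃; ∃-syntax; _×_; _,_)
open import Data.Sum using (_⊎_)
open import Relation.Nullary using (¬_)
open import Data.Empty using (⊥)
open import Relation.Nullary.Decidable using (_×-dec_)
open import Relation.Binary.PropositionalEquality using (_≡_)

-- A face (finite set of vertex labels in ℕ) is represented canonically
-- by a strictly increasing list.
Strict : List ℕ → Set
Strict = Linked _<_

Complex : Set₁
Complex = List ℕ → Set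

_⊆ₛ_ : List ℕ → List ℕ → Set
G ⊆ₛ F = ∀ x → x ∈ G → x ∈ F

Generated : (List ℕ → Set) → Complex
Generated Fac G = Strict G × ∃[ F ] (Fac F × G ⊆ₛ F)

between : ℕ → ℕ → List ℕ → ℕ
between a b S = length (filter (λ x → (a <? x) ×-dec (x <? b)) S)

-- Facets of ∂C(m,d) via Gale's evenness condition
CycFacet : ℕ → ℕ → List ℕ → Set
CycFacet m d S =
  Strict S × length S ≡ d × (∀ x → x ∈ S → 1 ≤ x × x ≤ m) ×
  (∀ a b → 1 ≤ a → a < b → b ≤ m → ¬ (a ∈ S) → ¬ (b ∈ S) → 2 ∣ between a b S)

BdC : ℕ → ℕ → Complex
BdC m d = Generated (CycFacet m d)

interval : ℕ → ℕ → List ℕ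
interval a j = applyUpTo (a +_) j

-- GamFacet J l n F : F is a union of intervals of sizes J (in order, each
-- entirely left of the next), all contained in {l, ..., n}.
GamFacet : List ℕ → ℕ → ℕ → List ℕ → Set
GamFacet [] l n F = F ≡ [] × l ≤ suc n
GamFacet (j ∷ J) l n F =
  ∃[ a ] ∃[ F' ] (l ≤ a × F ≡ interval a j ++ F' × GamFacet J (a + j) n F')

ΓFacet : List ℕ → ℕ → List ℕ → Set
ΓFacet J n = GamFacet J 1 n

Γ : List ℕ → ℕ → Complex
Γ J n = Generated (ΓFacet J n)

-- J = (2,...,2,3) for d even, (2,...,2,4) for d odd, summing to d+1
Jof : ℕ → List ℕ
Jof d = replicate (d / 2 ∸ 1) 2 ++ (3 + d % 2) ∷ []

BoundaryRidge : List ℕ → ℕ → ℕ → List ℕ → Set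
BoundaryRidge J n d G =
  Strict G × length G ≡ d ×
  ∃[ F ] (ΓFacet J n F × G ⊆ₛ F ×
          (∀ F' → ΓFacet J n F' → G ⊆ₛ F' → F' ≡ F))

-- D(n, e) with e = d - 1: boundary complex of Γ^{J(d)}_n
D : ℕ → ℕ → Complex
D n e = Generated (BoundaryRidge (Jof (suc e)) n (suc e))

lk : List ℕ → Complex → Complex
lk F Δ G =
  Δ G × (∀ x → x ∈ G → x ∈ F → ⊥) ×
  ∃[ H ] (Δ H × (∀ x → (x ∈ H → x ∈ G ⊎ x ∈ F) × (x ∈ G ⊎ x ∈ F → x ∈ H)))

{-# OPTIONS --safe #-}
-- Write d = 2k or 2k + 1 and c = 2 or 3 accordingly, so that J = (2, …, 2, c + 1) with k − 1 twos,
-- and put m = n − c: the face whose link is taken is the top block {m + 1, …, n}. Every facet of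
-- Γ^J_n through n is P ∪ {m, …, n} with P a union of k − 1 disjoint pairs {a, a + 1} below m, and a
-- set P ⊆ [1, m) is such a union exactly when an even number of elements of P lie below each gap of
-- P in [1, m]. Gale's evenness condition for S ⊆ [1, m] says that the parity of #{s ∈ S ∣ s < a} is
-- the same at every gap a of S in [1, m].
-- For |S| = 2k − 2, the facets containing S ∪ {m + 1, …, n} are the P ∪ {m, …, n} with S ⊆ P ∪ {m}.
-- If m ∉ S this forces P = S, so the ridge lies in exactly one facet iff S is a union of pairs, i.e.
-- iff S satisfies Gale's condition. If S = Q ∪ {m}, then P = Q ∪ {y} where y is a gap of Q at which
-- the parity of the number of elements below switches from even at the earlier gaps to odd at the
-- later ones; such a switch point is unique iff that parity is constant on the gaps, which is again
-- Gale's condition. So the boundary ridges of Γ^J_n through the top block are exactly the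
-- S ∪ {m + 1, …, n} with S a facet of ∂C(m, 2k − 2), and the link is ∂C(m, 2k − 2).

module Submission where

open import Defs
open import Data.Nat using (ℕ; zero; suc; pred; _+_; _*_; _∸_; _≤_; _<_; z≤n; s≤s; z<s; parity; >-nonZero)
open import Data.Nat.Properties
open import Data.Nat.Divisibility using (_∣_; divides; ∣-refl; ∣m∣n⇒∣m+n)
open import Data.Nat.DivMod using (_/_; _%_; m*n/n≡m; m<n⇒m/n≡0; m<n⇒m%n≡m; +-distrib-/-∣ʳ; [m+kn]%n≡m%n)
open import Data.Parity.Base using (Parity; 0ℙ; 1ℙ; _⁻¹) renaming (_+_ to _+ℙ_)
import Data.Parity.Properties as ℙ
open import Data.List using (List; []; _∷_; _++_; length; filter; replicate)
open import Data.List.Properties using (filter-accept; filter-reject; filter-none; filter-all; length-++; length-applyUpTo; ++-identityʳ; ++-cancelʳ)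
open import Data.List.Membership.Propositional using (_∈_; _∉_; find)
open import Data.List.Membership.Propositional.Properties using (∈-++⁺ˡ; ∈-++⁺ʳ; ∈-++⁻; ∈-filter⁺; ∈-filter⁻; ∈-applyUpTo⁺; ∈-applyUpTo⁻)
open import Data.List.Membership.DecPropositional _≟_ using (_∈?_)
open import Data.List.Relation.Unary.Any using (here; there)
open import Data.List.Relation.Unary.All as All using (All; []; _∷_; all?)
open import Data.List.Relation.Unary.All.Properties using (¬All⇒Any¬)
open import Data.List.Relation.Unary.AllPairs using (AllPairs; []; _∷_)
import Data.List.Relation.Unary.AllPairs.Properties as AllPairs
open import Data.List.Relation.Unary.Linked.Properties using (AllPairs⇒Linked; Linked⇒AllPairs)
import Data.List.Relation.Binary.Sublist.Propositional as Sublist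
import Data.List.Relation.Binary.Sublist.Propositional.Properties as Sublist
open import Data.List.Relation.Binary.Equality.Propositional using (≋⇒≡)
open import Data.List.Relation.Binary.Permutation.Propositional using (_↭_; ↭-refl; ↭-prep; ↭-swap; ↭-sym; ↭-trans)
open import Data.List.Relation.Binary.Permutation.Propositional.Properties using (∈-resp-↭; All-resp-↭; ↭-length; filter-↭; ++-comm)
open import Data.Product using (∃; ∃-syntax; ∃₂; ∃!; _×_; _,_; proj₁; proj₂)
open import Data.Sum using (_⊎_; inj₁; inj₂; [_,_])
open import Data.Empty using (⊥)
open import Function using (_∘_; case_of_)
open import Function.Bundles using (_⇔_; mk⇔; Equivalence)
open import Function.Construct.Composition using (_⇔-∘_)
import Function.Related.Propositional as Related
open import Relation.Nullary using (¬_; yes; no; ¬?; contradiction)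
open import Relation.Nullary.Decidable using (_×-dec_)
open import Relation.Unary using (Decidable)
open import Relation.Binary using (tri<; tri≈; tri>)
open import Relation.Binary.PropositionalEquality using (_≡_; _≢_; ≢-sym; refl; sym; trans; cong; cong₂; subst; module ≡-Reasoning)

open Equivalence using (to; from)

private
  variable
    a b l u x y z : ℕ
    xs ys S : List ℕ

-- Increasing lists as finite sets

Increasing : List ℕ → Set
Increasing = AllPairs _<_

increasing⇒strict : Increasing xs → Strict xs
increasing⇒strict = AllPairs⇒Linked

strict⇒increasing : Strict xs → Increasing xs
strict⇒increasing = Linked⇒AllPairs <-trans

head≤ : All (x <_) xs → z ∈ x ∷ xs → x ≤ z
head≤ _    (here refl)  = ≤-refl
head≤ x<xs (there z∈xs) = <⇒≤ (All.lookup x<xs z∈xs)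

∈-tail : z ∈ x ∷ xs → x < z → z ∈ xs
∈-tail (here refl)  x<x = contradiction x<x (<-irrefl refl)
∈-tail (there z∈xs) _   = z∈xs

⊆ₛ⇒sublist : Increasing xs → Increasing ys → xs ⊆ₛ ys → xs Sublist.⊆ ys
⊆ₛ⇒sublist {[]}     _ _ _ = Sublist.minimum _
⊆ₛ⇒sublist {x ∷ xs} {[]} _ _ sub with () ← sub x (here refl)
⊆ₛ⇒sublist {x ∷ xs} {y ∷ ys} (x<xs ∷ ixs) (y<ys ∷ iys) sub with sub x (here refl)
... | here refl  = refl Sublist.∷ ⊆ₛ⇒sublist ixs iys
                     (λ z z∈xs → ∈-tail (sub z (there z∈xs)) (All.lookup x<xs z∈xs))
... | there x∈ys = y Sublist.∷ʳ ⊆ₛ⇒sublist (x<xs ∷ ixs) iys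
                     (λ z z∈ → ∈-tail (sub z z∈) (<-≤-trans (All.lookup y<ys x∈ys) (head≤ x<xs z∈)))

length-mono-⊆ₛ : Increasing xs → Increasing ys → xs ⊆ₛ ys → length xs ≤ length ys
length-mono-⊆ₛ ixs iys = Sublist.length-mono-≤ ∘ ⊆ₛ⇒sublist ixs iys

⊆ₛ∧length⇒≡ : Increasing xs → Increasing ys → xs ⊆ₛ ys → length xs ≡ length ys → xs ≡ ys
⊆ₛ∧length⇒≡ ixs iys xs⊆ys eq = ≋⇒≡ (Sublist.to-≋ eq (⊆ₛ⇒sublist ixs iys xs⊆ys))

⊆ₛ-antisym : Increasing xs → Increasing ys → xs ⊆ₛ ys → ys ⊆ₛ xs → xs ≡ ys
⊆ₛ-antisym ixs iys xs⊆ys ys⊆xs =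
  Sublist.⊆-antisym (⊆ₛ⇒sublist ixs iys xs⊆ys) (⊆ₛ⇒sublist iys ixs ys⊆xs)

length<⇒∃∉ : Increasing xs → Increasing ys → length xs < length ys → ∃[ y ] (y ∈ ys × y ∉ xs)
length<⇒∃∉ {xs} {ys} ixs iys xs<ys with all? (_∈? xs) ys
... | yes ys⊆xs = contradiction (length-mono-⊆ₛ iys ixs (λ _ → All.lookup ys⊆xs)) (<⇒≱ xs<ys)
... | no  ys⊈xs = find (¬All⇒Any¬ (_∈? xs) ys ys⊈xs)

split-at : ∀ t {xs ys} → Increasing xs → Increasing ys → All (t ≤_) ys → ys ⊆ₛ xs →
           (∀ z → z ∈ xs → t ≤ z → z ∈ ys) → xs ≡ filter (_<? t) xs ++ ys
split-at t {xs} {ys} ixs iys t≤ys ys⊆xs above = ⊆ₛ-antisym ixs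
  (AllPairs.++⁺ (AllPairs.filter⁺ (_<? t) ixs) iys
     (All.tabulate λ z∈ → All.map (<-≤-trans (proj₂ (∈-filter⁻ (_<? t) {xs = xs} z∈))) t≤ys))
  split⁺ split⁻
  where
  split⁺ : xs ⊆ₛ (filter (_<? t) xs ++ ys)
  split⁺ z z∈xs with z <? t
  ... | yes z<t = ∈-++⁺ˡ (∈-filter⁺ (_<? t) z∈xs z<t)
  ... | no  z≮t = ∈-++⁺ʳ _ (above z z∈xs (≮⇒≥ z≮t))
  split⁻ : (filter (_<? t) xs ++ ys) ⊆ₛ xs
  split⁻ z z∈ with ∈-++⁻ (filter (_<? t) xs) z∈
  ... | inj₁ z∈filter = proj₁ (∈-filter⁻ (_<? t) {xs = xs} z∈filter)
  ... | inj₂ z∈ys     = ys⊆xs z z∈ys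

insert : ℕ → List ℕ → List ℕ
insert y []       = y ∷ []
insert y (x ∷ xs) with y <? x
... | yes _ = y ∷ x ∷ xs
... | no  _ = x ∷ insert y xs

insert-↭ : ∀ y xs → insert y xs ↭ y ∷ xs
insert-↭ y []       = ↭-refl
insert-↭ y (x ∷ xs) with y <? x
... | yes _ = ↭-refl
... | no  _ = ↭-trans (↭-prep x (insert-↭ y xs)) (↭-swap x y ↭-refl)

∈-insert⁻ : ∀ y xs → z ∈ insert y xs → z ∈ y ∷ xs
∈-insert⁻ y xs = ∈-resp-↭ (insert-↭ y xs)

∈-insert⁺ : ∀ y xs → z ∈ y ∷ xs → z ∈ insert y xs
∈-insert⁺ y xs = ∈-resp-↭ (↭-sym (insert-↭ y xs))

length-insert : ∀ y xs → length (insert y xs) ≡ suc (length xs)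
length-insert y xs = ↭-length (insert-↭ y xs)

insert-increasing : y ∉ xs → Increasing xs → Increasing (insert y xs)
insert-increasing {y} {[]}     _   []          = [] ∷ []
insert-increasing {y} {x ∷ xs} y∉ (x<xs ∷ ixs) with y <? x
... | yes y<x = (y<x ∷ All.map (<-trans y<x) x<xs) ∷ x<xs ∷ ixs
... | no  y≮x = All-resp-↭ (↭-sym (insert-↭ y xs)) (x<y ∷ x<xs) ∷ insert-increasing (y∉ ∘ there) ixs
  where
  x<y : x < y
  x<y = ≤∧≢⇒< (≮⇒≥ y≮x) (λ { refl → y∉ (here refl) })

insert-injective : y ∉ xs → insert y xs ≡ insert z xs → y ≡ z
insert-injective {y} {xs} {z} y∉xs eq with ∈-insert⁻ z xs (subst (y ∈_) eq (∈-insert⁺ y xs (here refl)))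
... | here y≡z    = y≡z
... | there y∈xs  = contradiction y∈xs y∉xs

∉-insert : z ≢ y → z ∉ xs → z ∉ insert y xs
∉-insert {y = y} {xs} z≢y z∉xs z∈ with ∈-insert⁻ y xs z∈
... | here z≡y   = z≢y z≡y
... | there z∈xs = z∉xs z∈xs

⊆ₛ∧length⇒≡insert : Increasing xs → Increasing ys → xs ⊆ₛ ys → length ys ≡ suc (length xs) →
                     ∃[ y ] (y ∈ ys × y ∉ xs × insert y xs ≡ ys)
⊆ₛ∧length⇒≡insert {xs} {ys} ixs iys xs⊆ys eq with length<⇒∃∉ ixs iys (≤-reflexive (sym eq))
... | y , y∈ys , y∉xs = y , y∈ys , y∉xs ,
  ⊆ₛ∧length⇒≡ (insert-increasing y∉xs ixs) iys insert⊆ys (trans (length-insert y xs) (sym eq))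
  where
  insert⊆ys : (insert y xs) ⊆ₛ ys
  insert⊆ys z z∈ with ∈-insert⁻ y xs z∈
  ... | here refl   = y∈ys
  ... | there z∈xs  = xs⊆ys z z∈xs

-- Parity of the number of elements below a point, and Gale's evenness condition

below : ℕ → List ℕ → ℕ
below a xs = length (filter (_<? a) xs)

below-↭ : ∀ a → xs ↭ ys → below a xs ≡ below a ys
below-↭ a xs↭ys = ↭-length (filter-↭ (_<? a) xs↭ys)

below-∷-< : x < a → below a (x ∷ xs) ≡ suc (below a xs)
below-∷-< x<a = cong length (filter-accept (_<? _) x<a)

below-∷-≥ : a ≤ x → below a (x ∷ xs) ≡ below a xs
below-∷-≥ a≤x = cong length (filter-reject (_<? _) (≤⇒≯ a≤x))

below-all-≥ : All (a ≤_) xs → below a xs ≡ 0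
below-all-≥ a≤xs = cong length (filter-none (_<? _) (All.map ≤⇒≯ a≤xs))

below-all-< : All (_< a) xs → below a xs ≡ length xs
below-all-< xs<a = cong length (filter-all (_<? _) xs<a)

between-∷-∈ : a < x → x < b → between a b (x ∷ xs) ≡ suc (between a b xs)
between-∷-∈ {a} {x} {b} a<x x<b = cong length (filter-accept (λ x → (a <? x) ×-dec (x <? b)) (a<x , x<b))

between-∷-∉ : ¬ (a < x × x < b) → between a b (x ∷ xs) ≡ between a b xs
between-∷-∉ {a} {x} {b} x∉ = cong length (filter-reject (λ x → (a <? x) ×-dec (x <? b)) x∉)

below-split : a ∉ xs → a < b → below b xs ≡ below a xs + between a b xs
below-split {xs = []} _ _ = refl
below-split {a} {x ∷ xs} {b} a∉ a<b with <-cmp x a | below-split {a} {xs} {b} (a∉ ∘ there) a<b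
... | tri≈ _ refl _ | _ = contradiction (here refl) a∉
... | tri< x<a _ _ | ih = begin
  below b (x ∷ xs)                        ≡⟨ below-∷-< (<-trans x<a a<b) ⟩
  suc (below b xs)                        ≡⟨ cong suc ih ⟩
  suc (below a xs) + between a b xs       ≡⟨ cong₂ _+_ (below-∷-< x<a) (between-∷-∉ (<-asym x<a ∘ proj₁)) ⟨
  below a (x ∷ xs) + between a b (x ∷ xs) ∎
  where open ≡-Reasoning
... | tri> _ _ a<x | ih with x <? b
...   | yes x<b = begin
  below b (x ∷ xs)                        ≡⟨ below-∷-< x<b ⟩
  suc (below b xs)                        ≡⟨ cong suc ih ⟩
  suc (below a xs + between a b xs)       ≡⟨ +-suc (below a xs) _ ⟨
  below a xs + suc (between a b xs)       ≡⟨ cong₂ _+_ (below-∷-≥ (<⇒≤ a<x)) (between-∷-∈ a<x x<b) ⟨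
  below a (x ∷ xs) + between a b (x ∷ xs) ∎
  where open ≡-Reasoning
...   | no  x≮b = begin
  below b (x ∷ xs)                        ≡⟨ below-∷-≥ (≮⇒≥ x≮b) ⟩
  below b xs                              ≡⟨ ih ⟩
  below a xs + between a b xs             ≡⟨ cong₂ _+_ (below-∷-≥ (<⇒≤ a<x)) (between-∷-∉ (x≮b ∘ proj₂)) ⟨
  below a (x ∷ xs) + between a b (x ∷ xs) ∎
  where open ≡-Reasoning

parity-suc : ∀ n → parity (suc n) ≡ parity n ⁻¹
parity-suc n = sym (ℙ.⁻¹-selfInverse (ℙ.suc-homo-⁻¹ n))

parity-2* : ∀ n → parity (2 * n) ≡ 0ℙ
parity-2* n = ℙ.*-homo-* 2 n

2∣⇒parity≡0ℙ : ∀ n → 2 ∣ n → parity n ≡ 0ℙ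
2∣⇒parity≡0ℙ n (divides q refl) = trans (cong parity (*-comm q 2)) (parity-2* q)

parity≡0ℙ⇒2∣ : ∀ n → parity n ≡ 0ℙ → 2 ∣ n
parity≡0ℙ⇒2∣ zero          _  = divides 0 refl
parity≡0ℙ⇒2∣ (suc (suc n)) eq = ∣m∣n⇒∣m+n ∣-refl (parity≡0ℙ⇒2∣ n eq)

parityBelow : List ℕ → ℕ → Parity
parityBelow xs a = parity (below a xs)

2∣between⇔parityBelow≡ : a ∉ xs → a < b → 2 ∣ between a b xs ⇔ parityBelow xs a ≡ parityBelow xs b
2∣between⇔parityBelow≡ {a} {xs} {b} a∉ a<b = mk⇔
  (λ 2∣ → trans (sym (ℙ.+-identityʳ πa)) (trans (cong (πa +ℙ_) (sym (2∣⇒parity≡0ℙ _ 2∣))) (sym split)))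
  (λ πa≡πb → parity≡0ℙ⇒2∣ _
    (sym (ℙ.+-cancelˡ-≡ πa _ _ (trans (ℙ.+-identityʳ πa) (trans πa≡πb split)))))
  where
  πa : Parity
  πa = parityBelow xs a
  split : parityBelow xs b ≡ πa +ℙ parity (between a b xs)
  split = trans (cong parity (below-split a∉ a<b)) (ℙ.+-homo-+ (below a xs) _)

Gap : ℕ → ℕ → List ℕ → ℕ → Set
Gap l u xs a = l ≤ a × a < u × a ∉ xs

gap? : ∀ l u xs → Decidable (Gap l u xs)
gap? l u xs a = (l ≤? a) ×-dec (a <? u) ×-dec ¬? (a ∈? xs)

UniformOn : (ℕ → Set) → (ℕ → Parity) → Set
UniformOn G π = ∀ {a b} → G a → G b → π a ≡ π b

UniformOn-cong : ∀ {G G′ π π′} → (∀ {a} → G a ⇔ G′ a) → (∀ {a} → G′ a → π a ≡ π′ a) →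
                 UniformOn G π ⇔ UniformOn G′ π′
UniformOn-cong {G} {G′} {π} {π′} G⇔G′ π≡π′ = mk⇔ uniform′ uniform
  where
  uniform′ : UniformOn G π → UniformOn G′ π′
  uniform′ uni G′a G′b =
    trans (sym (π≡π′ G′a)) (trans (uni (from G⇔G′ G′a) (from G⇔G′ G′b)) (π≡π′ G′b))
  uniform : UniformOn G′ π′ → UniformOn G π
  uniform uni Ga Gb =
    trans (π≡π′ (to G⇔G′ Ga)) (trans (uni (to G⇔G′ Ga) (to G⇔G′ Gb)) (sym (π≡π′ (to G⇔G′ Gb))))

Gale : ℕ → List ℕ → Set
Gale m xs = ∀ a b → 1 ≤ a → a < b → b ≤ m → ¬ (a ∈ xs) → ¬ (b ∈ xs) → 2 ∣ between a b xs

uniform⇔gale : ∀ m xs → UniformOn (Gap 1 (suc m) xs) (parityBelow xs) ⇔ Gale m xs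
uniform⇔gale m xs = mk⇔ gale uniform
  where
  uniform : Gale m xs → UniformOn (Gap 1 (suc m) xs) (parityBelow xs)
  uniform g {a} {b} (1≤a , a≤m , a∉) (1≤b , b≤m , b∉) with <-cmp a b
  ... | tri< a<b _ _ = to (2∣between⇔parityBelow≡ a∉ a<b) (g a b 1≤a a<b (≤-pred b≤m) a∉ b∉)
  ... | tri≈ _ refl _ = refl
  ... | tri> _ _ b<a = sym (to (2∣between⇔parityBelow≡ b∉ b<a) (g b a 1≤b b<a (≤-pred a≤m) b∉ a∉))
  gale : UniformOn (Gap 1 (suc m) xs) (parityBelow xs) → Gale m xs
  gale uni a b 1≤a a<b b≤m a∉ b∉ = from (2∣between⇔parityBelow≡ a∉ a<b)
    (uni (1≤a , s≤s (<⇒≤ (<-≤-trans a<b b≤m)) , a∉) (≤-trans 1≤a (<⇒≤ a<b) , s≤s b≤m , b∉))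

-- Switch points of a parity pattern on the gaps

module _ {P : ℕ → Set} (P? : Decidable P) where

  least : P b → ∃[ y ] (P y × ∀ {z} → P z → y ≤ z)
  least {b} Pb with search (suc b)
    where
    search : ∀ n → ∃[ y ] (P y × ∀ {z} → P z → y ≤ z) ⊎ (∀ {z} → P z → n ≤ z)
    search zero = inj₂ λ _ → z≤n
    search (suc n) with search n
    ... | inj₁ found = inj₁ found
    ... | inj₂ n≤ with P? n
    ...   | yes Pn  = inj₁ (n , Pn , n≤)
    ...   | no  ¬Pn = inj₂ λ Pz → ≤∧≢⇒< (n≤ Pz) λ { refl → ¬Pn Pz }
  ... | inj₁ found = found
  ... | inj₂ b<    = contradiction (b< Pb) (<-irrefl refl)

  greatest : (∀ {z} → P z → z < u) → P b → ∃[ y ] (P y × ∀ {z} → P z → z ≤ y)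
  greatest {u} bounded Pb with search u
    where
    search : ∀ n → ∃[ y ] (P y × ∀ {z} → P z → z < n → z ≤ y) ⊎ (∀ {z} → P z → n ≤ z)
    search zero = inj₂ λ _ → z≤n
    search (suc n) with P? n
    ... | yes Pn = inj₁ (n , Pn , λ _ → ≤-pred)
    ... | no ¬Pn with search n
    ...   | inj₁ (y , Py , max) =
      inj₁ (y , Py , λ Pz z<1+n → max Pz (≤∧≢⇒< (≤-pred z<1+n) λ { refl → ¬Pn Pz }))
    ...   | inj₂ n≤             = inj₂ λ Pz → ≤∧≢⇒< (n≤ Pz) λ { refl → ¬Pn Pz }
  ... | inj₁ (y , Py , max) = y , Py , λ Pz → max Pz (bounded Pz)
  ... | inj₂ u≤             = contradiction (u≤ Pb) (<⇒≱ (bounded Pb))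

Switch : (ℕ → Set) → (ℕ → Parity) → ℕ → Set
Switch G π y = G y × (∀ {b} → G b → b < y → π b ≡ 0ℙ) × (∀ {b} → G b → y < b → π b ≡ 1ℙ)

module _ {G : ℕ → Set} (G? : Decidable G) {u} (bounded : ∀ {a} → G a → a < u) (π : ℕ → Parity) where

  next-switch : Switch G π y → π y ≡ 0ℙ → G b → y < b → ∃[ y′ ] (Switch G π y′ × y < y′)
  next-switch {y} (_ , lo , hi) πy Gb y<b with least (λ z → G? z ×-dec y <? z) (Gb , y<b)
  ... | y′ , (Gy′ , y<y′) , min = y′ , (Gy′ , lo′ , λ Gz y′<z → hi Gz (<-trans y<y′ y′<z)) , y<y′
    where
    lo′ : ∀ {z} → G z → z < y′ → π z ≡ 0ℙ
    lo′ {z} Gz z<y′ with <-cmp z y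
    ... | tri< z<y _ _  = lo Gz z<y
    ... | tri≈ _ refl _ = πy
    ... | tri> _ _ y<z  = contradiction (min (Gz , y<z)) (<⇒≱ z<y′)

  previous-switch : Switch G π y → π y ≡ 1ℙ → G b → b < y → ∃[ y′ ] (Switch G π y′ × y′ < y)
  previous-switch {y} (_ , lo , hi) πy Gb b<y
    with greatest (λ z → G? z ×-dec z <? y) (λ (_ , z<y) → z<y) (Gb , b<y)
  ... | y′ , (Gy′ , y′<y) , max = y′ , (Gy′ , (λ Gz z<y′ → lo Gz (<-trans z<y′ y′<y)) , hi′) , y′<y
    where
    hi′ : ∀ {z} → G z → y′ < z → π z ≡ 1ℙ
    hi′ {z} Gz y′<z with <-cmp z y
    ... | tri< z<y _ _  = contradiction (max (Gz , z<y)) (<⇒≱ y′<z)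
    ... | tri≈ _ refl _ = πy
    ... | tri> _ _ y<z  = hi Gz y<z

  ∃!switch⇒uniform : ∃! _≡_ (Switch G π) → UniformOn G π
  ∃!switch⇒uniform (y , sw@(_ , lo , hi) , unique) Ga Gb = trans (≡πy Ga) (sym (≡πy Gb))
    where
    ≡πy : ∀ {a} → G a → π a ≡ π y
    ≡πy {a} Ga with <-cmp a y | π y in πy
    ... | tri≈ _ refl _ | _  = πy
    ... | tri< a<y _ _  | 0ℙ = lo Ga a<y
    ... | tri> _ _ y<a  | 1ℙ = hi Ga y<a
    ... | tri< a<y _ _  | 1ℙ = let y′ , sw′ , y′<y = previous-switch sw πy Ga a<y
                               in contradiction y′<y (<-irrefl (sym (unique sw′)))
    ... | tri> _ _ y<a  | 0ℙ = let y′ , sw′ , y<y′ = next-switch sw πy Ga y<a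
                               in contradiction y<y′ (<-irrefl (unique sw′))

  uniform⇒∃!switch : ∃ G → UniformOn G π → ∃! _≡_ (Switch G π)
  uniform⇒∃!switch (g , Gg) uniform with π g in πg
  ... | 0ℙ = let y , Gy , max = greatest G? bounded Gg in
    y , (Gy , (λ Gb _ → trans (uniform Gb Gg) πg) , λ Gb y<b → contradiction (max Gb) (<⇒≱ y<b)) ,
    λ {y′} (Gy′ , _ , hi′) → case <-cmp y y′ of λ where
      (tri< y<y′ _ _) → contradiction (max Gy′) (<⇒≱ y<y′)
      (tri≈ _ y≡y′ _) → y≡y′
      (tri> _ _ y′<y) → contradiction (trans (sym (hi′ Gy y′<y)) (trans (uniform Gy Gg) πg)) λ ()
  ... | 1ℙ = let y , Gy , min = least G? Gg in
    y , (Gy , (λ Gb b<y → contradiction (min Gb) (<⇒≱ b<y)) , λ Gb _ → trans (uniform Gb Gg) πg) ,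
    λ {y′} (Gy′ , lo′ , _) → case <-cmp y y′ of λ where
      (tri< y<y′ _ _) → contradiction (trans (sym (lo′ Gy y<y′)) (trans (uniform Gy Gg) πg)) λ ()
      (tri≈ _ y≡y′ _) → y≡y′
      (tri> _ _ y′<y) → contradiction (min Gy′) (<⇒≱ y′<y)

  ∃!switch⇔uniform : ∃ G → ∃! _≡_ (Switch G π) ⇔ UniformOn G π
  ∃!switch⇔uniform ∃G = mk⇔ ∃!switch⇒uniform (uniform⇒∃!switch ∃G)

∃!-image⇔∃! : ∀ {A B : Set} {P : A → Set} {Q : B → Set} (f : A → B) →
                 (∀ {x y} → P x → f x ≡ f y → x ≡ y) → (∀ {b} → Q b ⇔ (∃[ a ] (P a × f a ≡ b))) →
                 ∃! _≡_ Q ⇔ ∃! _≡_ P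
∃!-image⇔∃! f injective Q⇔ = mk⇔
  (λ (b , Qb , uniqueQ) → let a , Pa , fa≡b = to Q⇔ Qb in
    a , Pa , λ Pa′ → injective Pa (trans fa≡b (uniqueQ (from Q⇔ (_ , Pa′ , refl)))))
  (λ (a , Pa , uniqueP) → f a , from Q⇔ (a , Pa , refl) ,
    λ Qb′ → let a′ , Pa′ , fa′≡b′ = to Q⇔ Qb′ in trans (cong f (uniqueP Pa′)) fa′≡b′)

-- Unions of consecutive pairs

-- p disjoint pairs {a, a + 1} in [l, L): the pairs of a facet of Γ whose last interval starts at L.
PairUnion : ℕ → ℕ → ℕ → List ℕ → Set
PairUnion zero    l L xs = xs ≡ [] × l ≤ L
PairUnion (suc p) l L xs = ∃₂ λ a xs′ → l ≤ a × xs ≡ a ∷ suc a ∷ xs′ × PairUnion p (suc (suc a)) L xs′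

record EvenGapped (p l L : ℕ) (xs : List ℕ) : Set where
  field
    increasing : Increasing xs
    bounded    : All (λ z → l ≤ z × z < L) xs
    size       : length xs ≡ 2 * p
    l≤L        : l ≤ L
    evenGaps   : ∀ {a} → Gap l (suc L) xs a → parityBelow xs a ≡ 0ℙ

evenGapped-∷ : ∀ {p l L a xs} → l ≤ a → EvenGapped p (suc (suc a)) L xs →
               EvenGapped (suc p) l L (a ∷ suc a ∷ xs)
evenGapped-∷ {p} {l} {L} {a} {xs} l≤a eg = record
  { increasing = (n<1+n a ∷ All.map (<-trans (n<1+n a)) a+1<xs) ∷ a+1<xs ∷ increasing
  ; bounded    = (l≤a , <-trans (n<1+n a) l≤L) ∷ (m≤n⇒m≤1+n l≤a , l≤L) ∷
                 All.map (λ (a+2≤z , z<L) → ≤-trans l≤a+2 a+2≤z , z<L) bounded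
  ; size       = trans (cong (suc ∘ suc) size) (sym (*-suc 2 p))
  ; l≤L        = ≤-trans l≤a+2 l≤L
  ; evenGaps   = evenGaps′
  }
  where
  open EvenGapped eg
  a+1<xs : All (suc a <_) xs
  a+1<xs = All.map proj₁ bounded
  l≤a+2 : l ≤ suc (suc a)
  l≤a+2 = ≤-trans l≤a (≤-trans (n≤1+n a) (n≤1+n (suc a)))
  evenGaps′ : ∀ {b} → Gap l (suc L) (a ∷ suc a ∷ xs) b → parityBelow (a ∷ suc a ∷ xs) b ≡ 0ℙ
  evenGaps′ {b} (_ , b≤L , b∉) with <-cmp b a
  ... | tri< b<a _ _ = cong parity (below-all-≥ (<⇒≤ b<a ∷ <⇒≤ (<-trans b<a (n<1+n a)) ∷
                         All.map (λ a+1<z → <⇒≤ (<-trans b<a (<-trans (n<1+n a) a+1<z))) a+1<xs))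
  ... | tri≈ _ refl _ = contradiction (here refl) b∉
  ... | tri> _ _ a<b with b ≟ suc a
  ...   | yes refl  = contradiction (there (here refl)) b∉
  ...   | no b≢a+1 = trans (cong parity (trans (below-∷-< a<b) (cong suc (below-∷-< a+1<b))))
                       (evenGaps (a+1<b , b≤L , b∉ ∘ there ∘ there))
    where
    a+1<b : suc a < b
    a+1<b = ≤∧≢⇒< a<b (b≢a+1 ∘ sym)

-- Otherwise x + 1 would be a gap with exactly one element below it.
evenGapped-consecutive : ∀ {p l L x y xs} → EvenGapped p l L (x ∷ y ∷ xs) → y ≡ suc x
evenGapped-consecutive {x = x} {y} {xs} eg with y ≟ suc x
... | yes y≡x+1 = y≡x+1
... | no  y≢x+1
  with (x<y ∷ _) ∷ y<xs ∷ _ ← EvenGapped.increasing eg | (l≤x , _) ∷ (_ , y<L) ∷ _ ← EvenGapped.bounded eg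
  = contradiction (evenGaps (≤-trans l≤x (n≤1+n x) , <-trans x+1<y (s≤s (<⇒≤ y<L)) , x+1∉))
                  (λ even → contradiction (trans (cong parity (sym below≡1)) even) λ ())
  where
  open EvenGapped eg using (evenGaps)
  x+1<y : suc x < y
  x+1<y = ≤∧≢⇒< x<y (y≢x+1 ∘ sym)
  x+1∉ : suc x ∉ x ∷ y ∷ xs
  x+1∉ (here x+1≡x)          = <-irrefl (sym x+1≡x) (n<1+n x)
  x+1∉ (there (here refl))   = <-irrefl refl x+1<y
  x+1∉ (there (there x+1∈xs)) = <-asym x+1<y (All.lookup y<xs x+1∈xs)
  below≡1 : below (suc x) (x ∷ y ∷ xs) ≡ 1
  below≡1 = trans (below-∷-< (n<1+n x))
                  (cong suc (below-all-≥ (<⇒≤ x+1<y ∷ All.map (<⇒≤ ∘ <-trans x+1<y) y<xs)))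

evenGapped-tail : ∀ {p l L x xs} → EvenGapped (suc p) l L (x ∷ suc x ∷ xs) → EvenGapped p (suc (suc x)) L xs
evenGapped-tail {p} {x = x} {xs} eg
  with _ ∷ x+1<xs ∷ ixs ← EvenGapped.increasing eg | (l≤x , _) ∷ (_ , x+1<L) ∷ xs-bounds ← EvenGapped.bounded eg
  = record
  { increasing = ixs
  ; bounded    = All.zipWith (λ (x+1<z , _ , z<L) → x+1<z , z<L) (x+1<xs , xs-bounds)
  ; size       = suc-injective (suc-injective (trans size (*-suc 2 p)))
  ; l≤L        = x+1<L
  ; evenGaps   = λ {a} (x+1<a , a≤L , a∉xs) →
      trans (cong parity (sym (trans (below-∷-< (<-trans (n<1+n x) x+1<a)) (cong suc (below-∷-< x+1<a)))))
            (evenGaps (≤-trans l≤x (<⇒≤ (<-trans (n<1+n x) x+1<a)) , a≤L ,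
              λ { (here refl)          → <-asym (n<1+n _) x+1<a
                ; (there (here refl))  → <-irrefl refl x+1<a
                ; (there (there a∈xs)) → a∉xs a∈xs }))
  }
  where open EvenGapped eg using (size; evenGaps)

pairUnion⇒evenGapped : ∀ p {l L xs} → PairUnion p l L xs → EvenGapped p l L xs
pairUnion⇒evenGapped zero    (refl , l≤L) = record
  { increasing = [] ; bounded = [] ; size = refl ; l≤L = l≤L ; evenGaps = λ _ → refl }
pairUnion⇒evenGapped (suc p) (_ , _ , l≤a , refl , pu) = evenGapped-∷ l≤a (pairUnion⇒evenGapped p pu)

evenGapped⇒pairUnion : ∀ p {l L xs} → EvenGapped p l L xs → PairUnion p l L xs
evenGapped⇒pairUnion zero    {xs = []}        eg = refl , EvenGapped.l≤L eg
evenGapped⇒pairUnion (suc p) {xs = _ ∷ []}    eg with () ← trans (EvenGapped.size eg) (*-suc 2 p)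
evenGapped⇒pairUnion (suc p) {xs = x ∷ _ ∷ xs} eg with refl ← evenGapped-consecutive eg
  with (l≤x , _) ∷ _ ← EvenGapped.bounded eg
  = x , xs , l≤x , refl , evenGapped⇒pairUnion p (evenGapped-tail eg)

pairUnion-bounded : ∀ p {l L xs} → PairUnion p l L xs → z ∈ xs → l ≤ z × z < L
pairUnion-bounded p pu = All.lookup (EvenGapped.bounded (pairUnion⇒evenGapped p pu))

∈-interval⁻ : z ∈ interval a l → a ≤ z × z < a + l
∈-interval⁻ {a = a} z∈ with i , i<l , refl ← ∈-applyUpTo⁻ (a +_) z∈ = m≤m+n a i , +-monoʳ-< a i<l

∈-interval⁺ : a ≤ z → z < a + l → z ∈ interval a l
∈-interval⁺ {a} {z} {l} a≤z z<a+l = subst (_∈ interval a l) (m+[n∸m]≡n a≤z) (∈-applyUpTo⁺ (a +_) z∸a<l)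
  where
  z∸a<l : z ∸ a < l
  z∸a<l = subst (z ∸ a <_) (m+n∸m≡n a l) (∸-monoˡ-< z<a+l a≤z)

interval-increasing : ∀ a l → Increasing (interval a l)
interval-increasing a l = AllPairs.applyUpTo⁺₁ (a +_) l (λ i<j _ → +-monoʳ-< a i<j)

interval-2 : ∀ a → interval a 2 ≡ a ∷ suc a ∷ []
interval-2 a = cong₂ _∷_ (+-identityʳ a) (cong (_∷ []) (+-comm a 1))

interval-3 : ∀ a → interval a 3 ≡ a ∷ suc a ∷ suc (suc a) ∷ []
interval-3 a = cong₂ _∷_ (+-identityʳ a) (cong₂ _∷_ (+-comm a 1) (cong (_∷ []) (+-comm a 2)))

gamFacet⇒pairUnion : ∀ p {c l n F} → GamFacet (replicate p 2 ++ c ∷ []) l n F →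
                     ∃₂ λ a P → PairUnion p l a P × F ≡ P ++ interval a c × a + c ≤ suc n
gamFacet⇒pairUnion zero (a , _ , l≤a , refl , refl , a+c≤) = a , [] , (refl , l≤a) , ++-identityʳ _ , a+c≤
gamFacet⇒pairUnion (suc p) {c} (a , _ , l≤a , refl , facet) with gamFacet⇒pairUnion p facet
... | a′ , P , pu , refl , a′+c≤ =
  a′ , a ∷ suc a ∷ P , (a , P , l≤a , refl , subst (λ l → PairUnion p l a′ P) (+-comm a 2) pu) ,
  cong (_++ P ++ interval a′ c) (interval-2 a) , a′+c≤

pairUnion⇒gamFacet : ∀ p {c l n a P} → PairUnion p l a P → a + c ≤ suc n →
                     GamFacet (replicate p 2 ++ c ∷ []) l n (P ++ interval a c)
pairUnion⇒gamFacet zero (refl , l≤a) a+c≤ = _ , [] , l≤a , sym (++-identityʳ _) , refl , a+c≤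
pairUnion⇒gamFacet (suc p) {c} {a = a′} (a , P , l≤a , refl , pu) a′+c≤ =
  a , P ++ interval a′ c , l≤a , cong (_++ P ++ interval a′ c) (sym (interval-2 a)) ,
  pairUnion⇒gamFacet p (subst (λ l → PairUnion p l a′ P) (sym (+-comm a 2)) pu) a′+c≤

-- The link of the top block

module TopBlock (p c m : ℕ) (1≤c : 1 ≤ c) (2p<m : 2 * p < m) where

  n : ℕ
  n = m + c

  J : List ℕ
  J = replicate p 2 ++ suc c ∷ []

  Top : List ℕ
  Top = interval (suc m) c

  Last : List ℕ
  Last = interval m (suc c)

  Ridge : List ℕ → Set
  Ridge = BoundaryRidge J n (2 * p + c)

  1≤m : 1 ≤ m
  1≤m = ≤-trans (s≤s z≤n) 2p<m

  ∈Top⁻ : z ∈ Top → m < z × z ≤ n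
  ∈Top⁻ z∈ = let m<z , z<n+1 = ∈-interval⁻ z∈ in m<z , ≤-pred z<n+1

  ∈Top⁺ : m < z → z ≤ n → z ∈ Top
  ∈Top⁺ m<z z≤top = ∈-interval⁺ m<z (s≤s z≤top)

  ∈Last⁻ : z ∈ Last → m ≤ z × z ≤ n
  ∈Last⁻ {z} z∈ = let m≤z , z<m+1+c = ∈-interval⁻ z∈ in m≤z , ≤-pred (subst (z <_) (+-suc m c) z<m+1+c)

  ∈Last⁺ : m ≤ z → z ≤ n → z ∈ Last
  ∈Last⁺ {z} m≤z z≤top = ∈-interval⁺ m≤z (subst (z <_) (sym (+-suc m c)) (s≤s z≤top))

  n∈Top : n ∈ Top
  n∈Top = ∈Top⁺ (m<m+n m 1≤c) ≤-refl

  ++Top-increasing : Increasing xs → (∀ z → z ∈ xs → z ≤ m) → Increasing (xs ++ Top)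
  ++Top-increasing ixs xs≤m = AllPairs.++⁺ ixs (interval-increasing (suc m) c)
    (All.tabulate λ z∈xs → All.tabulate λ w∈Top → ≤-<-trans (xs≤m _ z∈xs) (proj₁ (∈Top⁻ w∈Top)))

  pairUnion⇒facet : ∀ {P} → PairUnion p 1 m P → ΓFacet J n (P ++ Last)
  pairUnion⇒facet pu = pairUnion⇒gamFacet p pu (≤-reflexive (+-suc m c))

  facet-through-n : ∀ {F} → ΓFacet J n F → n ∈ F → ∃[ P ] (PairUnion p 1 m P × F ≡ P ++ Last)
  facet-through-n facet n∈F with gamFacet⇒pairUnion p facet
  ... | a , P , pu , refl , a+1+c≤n+1 =
    P , subst (λ a′ → PairUnion p 1 a′ P × P ++ interval a (suc c) ≡ P ++ interval a′ (suc c))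
              (≤-antisym a≤m m≤a) (pu , refl)
    where
    a≤m : a ≤ m
    a≤m = +-cancelʳ-≤ c a m (≤-pred (subst (_≤ suc n) (+-suc a c) a+1+c≤n+1))
    m≤a : m ≤ a
    m≤a with ∈-++⁻ P n∈F
    ... | inj₁ n∈P = contradiction (≤-trans a≤m (m≤m+n m c)) (<⇒≱ (proj₂ (pairUnion-bounded p pu n∈P)))
    ... | inj₂ n∈I = +-cancelʳ-≤ c m a (≤-pred (subst (n <_) (+-suc a c) (proj₂ (∈-interval⁻ n∈I))))

  facet-bounded : ∀ {P} → PairUnion p 1 m P → z ∈ P ++ Last → 1 ≤ z × z ≤ n
  facet-bounded {P = P} pu z∈ with ∈-++⁻ P z∈
  ... | inj₁ z∈P    = let 1≤z , z<m = pairUnion-bounded p pu z∈P in 1≤z , ≤-trans (<⇒≤ z<m) (m≤m+n m c)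
  ... | inj₂ z∈Last = let m≤z , z≤top = ∈Last⁻ z∈Last in ≤-trans 1≤m m≤z , z≤top

  ridge-bounded : ∀ {R} → Ridge R → n ∈ R → ∀ z → z ∈ R → 1 ≤ z × z ≤ n
  ridge-bounded (_ , _ , F , facet , R⊆F , _) n∈R z z∈R with facet-through-n facet (R⊆F n n∈R)
  ... | P , pu , refl = facet-bounded pu (R⊆F z z∈R)

  -- The facets of Γ containing S ++ Top are the P ++ Last with Covering S P (see ridge⇔covering).
  Covering : List ℕ → List ℕ → Set
  Covering S P = PairUnion p 1 m P × S ⊆ₛ (m ∷ P)

  ⊆++Last⇒⊆∷ : ∀ {P} → (∀ z → z ∈ S → z ≤ m) → S ⊆ₛ (P ++ Last) → S ⊆ₛ (m ∷ P)
  ⊆++Last⇒⊆∷ {P = P} S≤m S⊆ z z∈S with ∈-++⁻ P (S⊆ z z∈S)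
  ... | inj₁ z∈P    = there z∈P
  ... | inj₂ z∈Last = here (≤-antisym (S≤m z z∈S) (proj₁ (∈Last⁻ z∈Last)))

  ⊆∷⇒++Top⊆++Last : ∀ {P} → S ⊆ₛ (m ∷ P) → (S ++ Top) ⊆ₛ (P ++ Last)
  ⊆∷⇒++Top⊆++Last {S} {P} S⊆ z z∈ with ∈-++⁻ S z∈
  ... | inj₂ z∈Top = ∈-++⁺ʳ P (let m<z , z≤top = ∈Top⁻ z∈Top in ∈Last⁺ (<⇒≤ m<z) z≤top)
  ... | inj₁ z∈S with S⊆ z z∈S
  ...   | here refl = ∈-++⁺ʳ P (∈Last⁺ ≤-refl (m≤m+n m c))
  ...   | there z∈P = ∈-++⁺ˡ z∈P

  ridge⇔covering : Increasing S → (∀ z → z ∈ S → 1 ≤ z × z ≤ m) →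
                   Ridge (S ++ Top) ⇔ (length S ≡ 2 * p × ∃! _≡_ (Covering S))
  ridge⇔covering {S} incS bounds = mk⇔ covering ridge
    where
    S≤m : ∀ z → z ∈ S → z ≤ m
    S≤m z = proj₂ ∘ bounds z
    length-S++Top : length (S ++ Top) ≡ length S + c
    length-S++Top = trans (length-++ S) (cong (length S +_) (length-applyUpTo _ c))
    covering : Ridge (S ++ Top) → length S ≡ 2 * p × ∃! _≡_ (Covering S)
    covering (_ , size , F , facet , S++Top⊆F , unique)
      with facet-through-n facet (S++Top⊆F n (∈-++⁺ʳ S n∈Top))
    ... | P , pu , refl =
      +-cancelʳ-≡ c _ _ (trans (sym length-S++Top) size) ,
      P , (pu , ⊆++Last⇒⊆∷ S≤m (λ z → S++Top⊆F z ∘ ∈-++⁺ˡ)) ,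
      λ {P′} (pu′ , S⊆m∷P′) →
        sym (++-cancelʳ Last P′ P (unique (P′ ++ Last) (pairUnion⇒facet pu′) (⊆∷⇒++Top⊆++Last S⊆m∷P′)))
    ridge : length S ≡ 2 * p × ∃! _≡_ (Covering S) → Ridge (S ++ Top)
    ridge (size , P , (pu , S⊆m∷P) , unique) =
      increasing⇒strict (++Top-increasing incS S≤m) , trans length-S++Top (cong (_+ c) size) ,
      P ++ Last , pairUnion⇒facet pu , ⊆∷⇒++Top⊆++Last S⊆m∷P , unique′
      where
      unique′ : ∀ F′ → ΓFacet J n F′ → (S ++ Top) ⊆ₛ F′ → F′ ≡ P ++ Last
      unique′ F′ facet′ S++Top⊆F′ with facet-through-n facet′ (S++Top⊆F′ n (∈-++⁺ʳ S n∈Top))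
      ... | P′ , pu′ , refl =
        cong (_++ Last) (sym (unique (pu′ , ⊆++Last⇒⊆∷ S≤m (λ z → S++Top⊆F′ z ∘ ∈-++⁺ˡ))))

  covering⇒≡ : m ∉ S → Increasing S → length S ≡ 2 * p → ∀ {P} → Covering S P → S ≡ P
  covering⇒≡ {S} m∉S incS size {P} (pu , S⊆m∷P) =
    ⊆ₛ∧length⇒≡ incS increasing S⊆P (trans size (sym (EvenGapped.size eg)))
    where
    eg : EvenGapped p 1 m P
    eg = pairUnion⇒evenGapped p pu
    open EvenGapped eg using (increasing)
    S⊆P : S ⊆ₛ P
    S⊆P z z∈S with S⊆m∷P z z∈S
    ... | here refl = contradiction z∈S m∉S
    ... | there z∈P = z∈P

  ∃!covering⇔pairUnion : m ∉ S → Increasing S → length S ≡ 2 * p → ∃! _≡_ (Covering S) ⇔ PairUnion p 1 m S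
  ∃!covering⇔pairUnion {S} m∉S incS size = mk⇔ pairUnion ∃!covering
    where
    pairUnion : ∃! _≡_ (Covering S) → PairUnion p 1 m S
    pairUnion (P , cov , _) = subst (PairUnion p 1 m) (sym (covering⇒≡ m∉S incS size cov)) (proj₁ cov)
    ∃!covering : PairUnion p 1 m S → ∃! _≡_ (Covering S)
    ∃!covering pu = S , (pu , λ _ → there) , covering⇒≡ m∉S incS size

  pairUnion⇔gale : m ∉ S → Increasing S → (∀ z → z ∈ S → 1 ≤ z × z ≤ m) → length S ≡ 2 * p →
                   PairUnion p 1 m S ⇔ Gale m S
  pairUnion⇔gale {S} m∉S incS bounds size = mk⇔
    (λ pu → let open EvenGapped (pairUnion⇒evenGapped p pu) in
      to (uniform⇔gale m S) λ Ga Gb → trans (evenGaps Ga) (sym (evenGaps Gb)))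
    (λ gale → evenGapped⇒pairUnion p record
      { increasing = incS
      ; bounded    = S-bounded
      ; size       = size
      ; l≤L        = 1≤m
      ; evenGaps   = λ Ga → trans (from (uniform⇔gale m S) gale Ga (1≤m , ≤-refl , m∉S)) parity-m
      })
    where
    S-bounded : All (λ z → 1 ≤ z × z < m) S
    S-bounded = All.tabulate λ {z} z∈S →
      proj₁ (bounds z z∈S) , ≤∧≢⇒< (proj₂ (bounds z z∈S)) λ { refl → m∉S z∈S }
    parity-m : parityBelow S m ≡ 0ℙ
    parity-m = trans (cong parity (trans (below-all-< (All.map proj₂ S-bounded)) size)) (parity-2* p)

  module WithMaximum (Q : List ℕ) (incQ : Increasing Q) (Q-bounded : All (λ z → 1 ≤ z × z < m) Q)
                     (size : suc (length Q) ≡ 2 * p) where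

    SwitchQ : ℕ → Set
    SwitchQ = Switch (Gap 1 m Q) (parityBelow Q)

    parityBelow-insert : ∀ y b → parityBelow (insert y Q) b ≡ parityBelow (y ∷ Q) b
    parityBelow-insert y b = cong parity (below-↭ b (insert-↭ y Q))

    pairUnion⇒switch : Gap 1 m Q y → PairUnion p 1 m (insert y Q) → SwitchQ y
    pairUnion⇒switch {y} Gy pu = Gy , lo , hi
      where
      open EvenGapped (pairUnion⇒evenGapped p pu) using (evenGaps)
      even : Gap 1 m Q b → b ≢ y → parityBelow (y ∷ Q) b ≡ 0ℙ
      even (1≤b , b<m , b∉Q) b≢y =
        trans (sym (parityBelow-insert y _)) (evenGaps (1≤b , m<n⇒m<1+n b<m , ∉-insert b≢y b∉Q))
      lo : Gap 1 m Q b → b < y → parityBelow Q b ≡ 0ℙ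
      lo Gb b<y = trans (cong parity (sym (below-∷-≥ (<⇒≤ b<y)))) (even Gb (<⇒≢ b<y))
      hi : Gap 1 m Q b → y < b → parityBelow Q b ≡ 1ℙ
      hi {b} Gb y<b = sym (ℙ.⁻¹-selfInverse (begin
        parityBelow Q b ⁻¹      ≡⟨ parity-suc (below b Q) ⟨
        parity (suc (below b Q)) ≡⟨ cong parity (below-∷-< y<b) ⟨
        parityBelow (y ∷ Q) b    ≡⟨ even Gb (≢-sym (<⇒≢ y<b)) ⟩
        0ℙ                       ∎))
        where open ≡-Reasoning

    switch⇒pairUnion : Gap 1 m Q y → SwitchQ y → PairUnion p 1 m (insert y Q)
    switch⇒pairUnion {y} (1≤y , y<m , y∉Q) (_ , lo , hi) = evenGapped⇒pairUnion p record
      { increasing = insert-increasing y∉Q incQ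
      ; bounded    = All-resp-↭ (↭-sym (insert-↭ y Q)) ((1≤y , y<m) ∷ Q-bounded)
      ; size       = trans (length-insert y Q) size
      ; l≤L        = 1≤m
      ; evenGaps   = λ Ga → trans (parityBelow-insert y _) (even Ga)
      }
      where
      gapQ : Gap 1 (suc m) (insert y Q) a → m ≢ a → Gap 1 m Q a
      gapQ (1≤a , a≤m , a∉) m≢a = 1≤a , ≤∧≢⇒< (≤-pred a≤m) (≢-sym m≢a) , a∉ ∘ ∈-insert⁺ y Q ∘ there
      even : Gap 1 (suc m) (insert y Q) a → parityBelow (y ∷ Q) a ≡ 0ℙ
      even {a} Ga@(_ , _ , a∉) with m ≟ a | <-cmp a y
      ... | yes refl | _             =
        trans (cong parity (trans (below-all-< (y<m ∷ All.map proj₂ Q-bounded)) size)) (parity-2* p)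
      ... | no m≢a   | tri< a<y _ _  = trans (cong parity (below-∷-≥ (<⇒≤ a<y))) (lo (gapQ Ga m≢a) a<y)
      ... | no _     | tri≈ _ refl _ = contradiction (∈-insert⁺ y Q (here refl)) a∉
      ... | no m≢a   | tri> _ _ y<a  =
        trans (cong parity (below-∷-< y<a)) (trans (parity-suc (below a Q)) (cong _⁻¹ (hi (gapQ Ga m≢a) y<a)))

    covering⇔switch : ∀ {P} → Covering (Q ++ m ∷ []) P ⇔ (∃[ y ] (SwitchQ y × insert y Q ≡ P))
    covering⇔switch {P} = mk⇔ switch covering
      where
      switch : Covering (Q ++ m ∷ []) P → ∃[ y ] (SwitchQ y × insert y Q ≡ P)
      switch (pu , S⊆m∷P) with ⊆ₛ∧length⇒≡insert incQ increasing Q⊆P (trans size′ (sym size))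
        where
        open EvenGapped (pairUnion⇒evenGapped p pu) renaming (size to size′)
        Q⊆P : Q ⊆ₛ P
        Q⊆P z z∈Q with S⊆m∷P z (∈-++⁺ˡ z∈Q)
        ... | here refl = contradiction (proj₂ (All.lookup Q-bounded z∈Q)) (<-irrefl refl)
        ... | there z∈P = z∈P
      ... | y , y∈P , y∉Q , insert≡P =
        let 1≤y , y<m = pairUnion-bounded p pu y∈P in
        y , pairUnion⇒switch (1≤y , y<m , y∉Q) (subst (PairUnion p 1 m) (sym insert≡P) pu) , insert≡P
      covering : ∃[ y ] (SwitchQ y × insert y Q ≡ P) → Covering (Q ++ m ∷ []) P
      covering (y , sw@(Gy , _) , refl) = switch⇒pairUnion Gy sw , S⊆m∷P
        where
        S⊆m∷P : (Q ++ m ∷ []) ⊆ₛ (m ∷ insert y Q)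
        S⊆m∷P z z∈ with ∈-++⁻ Q z∈
        ... | inj₁ z∈Q        = there (∈-insert⁺ y Q (there z∈Q))
        ... | inj₂ (here refl) = here refl

    ∃gap : ∃ (Gap 1 m Q)
    ∃gap with length<⇒∃∉ incQ (interval-increasing 1 (pred m)) Q<pred-m
      where
      Q<pred-m : length Q < length (interval 1 (pred m))
      Q<pred-m = subst (length Q <_) (sym (length-applyUpTo _ (pred m))) (<⇒≤pred (subst (_< m) (sym size) 2p<m))
    ... | y , y∈ , y∉Q = let 1≤y , y≤pred-m = ∈-interval⁻ y∈ in
      y , 1≤y , <-≤-trans y≤pred-m (≤-reflexive (suc-pred m {{>-nonZero 1≤m}})) , y∉Q

    uniformQ⇔uniform : UniformOn (Gap 1 m Q) (parityBelow Q) ⇔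
                       UniformOn (Gap 1 (suc m) (Q ++ m ∷ [])) (parityBelow (Q ++ m ∷ []))
    uniformQ⇔uniform = UniformOn-cong (mk⇔ gap gapQ) λ (_ , a≤m , _) →
      cong parity (sym (trans (below-↭ _ (++-comm Q (m ∷ []))) (below-∷-≥ (≤-pred a≤m))))
      where
      gap : Gap 1 m Q a → Gap 1 (suc m) (Q ++ m ∷ []) a
      gap (1≤a , a<m , a∉Q) = 1≤a , m<n⇒m<1+n a<m , λ a∈ → case ∈-++⁻ Q a∈ of λ where
        (inj₁ a∈Q) → a∉Q a∈Q
        (inj₂ (here refl)) → <-irrefl refl a<m
      gapQ : Gap 1 (suc m) (Q ++ m ∷ []) a → Gap 1 m Q a
      gapQ (1≤a , a≤m , a∉) =
        1≤a , ≤∧≢⇒< (≤-pred a≤m) (λ { refl → a∉ (∈-++⁺ʳ Q (here refl)) }) , a∉ ∘ ∈-++⁺ˡ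

    ∃!covering⇔∃!switch : ∃! _≡_ (Covering (Q ++ m ∷ [])) ⇔ ∃! _≡_ SwitchQ
    ∃!covering⇔∃!switch =
      ∃!-image⇔∃! (λ y → insert y Q) (λ ((_ , _ , y∉Q) , _) → insert-injective y∉Q) covering⇔switch

    ∃!covering⇔gale : ∃! _≡_ (Covering (Q ++ m ∷ [])) ⇔ Gale m (Q ++ m ∷ [])
    ∃!covering⇔gale = begin
      ∃! _≡_ (Covering (Q ++ m ∷ []))                                   ∼⟨ ∃!covering⇔∃!switch ⟩
      ∃! _≡_ SwitchQ                                                    ∼⟨ ∃!switch⇔uniform (gap? 1 m Q) (proj₁ ∘ proj₂) _ ∃gap ⟩
      UniformOn (Gap 1 m Q) (parityBelow Q)                             ∼⟨ uniformQ⇔uniform ⟩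
      UniformOn (Gap 1 (suc m) (Q ++ m ∷ [])) (parityBelow (Q ++ m ∷ [])) ∼⟨ uniform⇔gale m (Q ++ m ∷ []) ⟩
      Gale m (Q ++ m ∷ [])                                              ∎
      where open Related.EquationalReasoning {k = Related.equivalence}

  ∃!covering⇔gale : Increasing S → (∀ z → z ∈ S → 1 ≤ z × z ≤ m) → length S ≡ 2 * p →
                    ∃! _≡_ (Covering S) ⇔ Gale m S
  ∃!covering⇔gale {S} incS bounds size with m ∈? S
  ... | no m∉S = pairUnion⇔gale m∉S incS bounds size ⇔-∘ ∃!covering⇔pairUnion m∉S incS size
  ... | yes m∈S = subst (λ S → ∃! _≡_ (Covering S) ⇔ Gale m S) (sym S≡Q++m)
                    (WithMaximum.∃!covering⇔gale Q incQ Q-bounded sizeQ)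
    where
    Q : List ℕ
    Q = filter (_<? m) S
    S≡Q++m : S ≡ Q ++ m ∷ []
    S≡Q++m = split-at m incS ([] ∷ []) (≤-refl ∷ []) (λ { _ (here refl) → m∈S })
               λ z z∈S m≤z → here (≤-antisym (proj₂ (bounds z z∈S)) m≤z)
    incQ : Increasing Q
    incQ = AllPairs.filter⁺ (_<? m) incS
    Q-bounded : All (λ z → 1 ≤ z × z < m) Q
    Q-bounded = All.tabulate λ {z} z∈Q →
      let z∈S , z<m = ∈-filter⁻ (_<? m) {xs = S} z∈Q in proj₁ (bounds z z∈S) , z<m
    sizeQ : suc (length Q) ≡ 2 * p
    sizeQ = trans (+-comm 1 (length Q)) (trans (sym (length-++ Q)) (trans (cong length (sym S≡Q++m)) size))

  ridge⇔cycFacet : Increasing S → (∀ z → z ∈ S → 1 ≤ z × z ≤ m) → Ridge (S ++ Top) ⇔ CycFacet m (2 * p) S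
  ridge⇔cycFacet incS bounds = mk⇔
    (λ ridge → let size , ∃!covering = to (ridge⇔covering incS bounds) ridge in
      increasing⇒strict incS , size , bounds , to (∃!covering⇔gale incS bounds size) ∃!covering)
    (λ (_ , size , _ , gale) → from (ridge⇔covering incS bounds) (size , from (∃!covering⇔gale incS bounds size) gale))

  lk⇒bdC : ∀ {G} → Strict G → lk Top (Generated Ridge) G → BdC m (2 * p) G
  lk⇒bdC {G} sG (_ , G∩Top≡∅ , H , (_ , R , ridge , H⊆R) , H≡G∪Top) =
    sG , S₀ , to (ridge⇔cycFacet incS₀ S₀-bounded) (subst Ridge R≡S₀++Top ridge) , G⊆S₀
    where
    Top⊆R : Top ⊆ₛ R
    Top⊆R z z∈Top = H⊆R z (proj₂ (H≡G∪Top z) (inj₂ z∈Top))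
    G⊆R : G ⊆ₛ R
    G⊆R z z∈G = H⊆R z (proj₂ (H≡G∪Top z) (inj₁ z∈G))
    R-bounded : ∀ z → z ∈ R → 1 ≤ z × z ≤ n
    R-bounded = ridge-bounded ridge (Top⊆R n n∈Top)
    incR : Increasing R
    incR = strict⇒increasing (proj₁ ridge)
    S₀ : List ℕ
    S₀ = filter (_<? suc m) R
    R≡S₀++Top : R ≡ S₀ ++ Top
    R≡S₀++Top = split-at (suc m) incR (interval-increasing (suc m) c) (All.tabulate (proj₁ ∘ ∈Top⁻)) Top⊆R
                 λ z z∈R m<z → ∈Top⁺ m<z (proj₂ (R-bounded z z∈R))
    incS₀ : Increasing S₀
    incS₀ = AllPairs.filter⁺ (_<? suc m) incR
    S₀-bounded : ∀ z → z ∈ S₀ → 1 ≤ z × z ≤ m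
    S₀-bounded z z∈S₀ =
      let z∈R , z<m+1 = ∈-filter⁻ (_<? suc m) {xs = R} z∈S₀ in proj₁ (R-bounded z z∈R) , ≤-pred z<m+1
    G⊆S₀ : G ⊆ₛ S₀
    G⊆S₀ z z∈G = ∈-filter⁺ (_<? suc m) (G⊆R z z∈G)
      (s≤s (≮⇒≥ λ m<z → G∩Top≡∅ z z∈G (∈Top⁺ m<z (proj₂ (R-bounded z (G⊆R z z∈G))))))

  bdC⇒lk : ∀ {G} → Strict G → BdC m (2 * p) G → lk Top (Generated Ridge) G
  bdC⇒lk {G} sG (_ , S , cyc@(sS , _ , S-bounded , _) , G⊆S) =
    (sG , S ++ Top , ridge , G⊆R) , G∩Top≡∅ ,
    G ++ Top , (increasing⇒strict (++Top-increasing (strict⇒increasing sG) G≤m) , S ++ Top , ridge , H⊆R) ,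
    λ z → ∈-++⁻ G , [ ∈-++⁺ˡ , ∈-++⁺ʳ G ]
    where
    ridge : Ridge (S ++ Top)
    ridge = from (ridge⇔cycFacet (strict⇒increasing sS) S-bounded) cyc
    G⊆R : G ⊆ₛ (S ++ Top)
    G⊆R z = ∈-++⁺ˡ ∘ G⊆S z
    G≤m : ∀ z → z ∈ G → z ≤ m
    G≤m z = proj₂ ∘ S-bounded z ∘ G⊆S z
    G∩Top≡∅ : ∀ z → z ∈ G → z ∈ Top → ⊥
    G∩Top≡∅ z z∈G z∈Top = <⇒≱ (proj₁ (∈Top⁻ z∈Top)) (G≤m z z∈G)
    H⊆R : (G ++ Top) ⊆ₛ (S ++ Top)
    H⊆R z z∈ = [ G⊆R z , ∈-++⁺ʳ S ] (∈-++⁻ G z∈)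

  lk⇔bdC : ∀ G → Strict G → lk Top (Generated Ridge) G ⇔ BdC m (2 * p) G
  lk⇔bdC G sG = mk⇔ (lk⇒bdC sG) (bdC⇒lk sG)

-- The cases d = 2k and d = 2k + 1

Jof-pairs : ∀ p r → r < 2 → Jof (r + suc p * 2) ≡ replicate p 2 ++ 3 + r ∷ []
Jof-pairs p r r<2 = cong₂ (λ h t → replicate (h ∸ 1) 2 ++ 3 + t ∷ []) half rem
  where
  half : (r + suc p * 2) / 2 ≡ suc p
  half = trans (+-distrib-/-∣ʳ r (divides (suc p) refl)) (cong₂ _+_ (m<n⇒m/n≡0 r<2) (m*n/n≡m (suc p) 2))
  rem : (r + suc p * 2) % 2 ≡ r
  rem = trans ([m+kn]%n≡m%n r (suc p) 2) (m<n⇒m%n≡m r<2)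

lk-top⇔bdC : ∀ p c m → 1 ≤ c → 2 * p < m → ∀ {Fl J n d e} →
             Fl ≡ interval (suc m) c → J ≡ replicate p 2 ++ suc c ∷ [] → n ≡ m + c →
             d ≡ 2 * p + c → e ≡ 2 * p →
             ∀ G → Strict G → lk Fl (Generated (BoundaryRidge J n d)) G ⇔ BdC m e G
lk-top⇔bdC p c m 1≤c 2p<m refl refl refl refl refl = TopBlock.lk⇔bdC p c m 1≤c 2p<m

lemma4p8 : ∀ (k : ℕ) → 2 ≤ k →
    (∀ (n : ℕ) → 2 * k + 1 ≤ n → ∀ (G : List ℕ) → Strict G →
       lk (n ∸ 1 ∷ n ∷ []) (D n (2 * k ∸ 1)) G ⇔ BdC (n ∸ 2) (2 * k ∸ 2) G)
    × (∀ (n : ℕ) → 2 * k + 2 ≤ n → ∀ (G : List ℕ) → Strict G →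
       lk (n ∸ 2 ∷ n ∸ 1 ∷ n ∷ []) (D n (2 * k)) G ⇔ BdC (n ∸ 3) (2 * k ∸ 2) G)
lemma4p8 (suc zero) (s≤s ())
lemma4p8 k@(suc p@(suc _)) _ = even , odd
  where
  2k≡ : 2 * k ≡ 2 + 2 * p
  2k≡ = *-suc 2 p
  e≡ : 2 * k ∸ 2 ≡ 2 * p
  e≡ = cong (_∸ 2) 2k≡

  even : ∀ n → 2 * k + 1 ≤ n → ∀ G → Strict G →
         lk (n ∸ 1 ∷ n ∷ []) (D n (2 * k ∸ 1)) G ⇔ BdC (n ∸ 2) (2 * k ∸ 2) G
  even n n≥ with subst (_≤ n) (trans (+-comm (2 * k) 1) (cong suc 2k≡)) n≥
  ... | s≤s (s≤s (s≤s 2p≤m-1)) =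
    lk-top⇔bdC p 2 _ (s≤s z≤n) (s≤s 2p≤m-1) (sym (interval-2 _)) J≡ (+-comm 2 _) d≡ e≡
    where
    d≡2k : suc (2 * k ∸ 1) ≡ 2 * k
    d≡2k = trans (cong (λ t → suc (t ∸ 1)) 2k≡) (sym 2k≡)
    J≡ : Jof (suc (2 * k ∸ 1)) ≡ replicate p 2 ++ 3 ∷ []
    J≡ = trans (cong Jof (trans d≡2k (*-comm 2 k))) (Jof-pairs p 0 z<s)
    d≡ : suc (2 * k ∸ 1) ≡ 2 * p + 2
    d≡ = trans d≡2k (trans 2k≡ (+-comm 2 (2 * p)))

  odd : ∀ n → 2 * k + 2 ≤ n → ∀ G → Strict G →
        lk (n ∸ 2 ∷ n ∸ 1 ∷ n ∷ []) (D n (2 * k)) G ⇔ BdC (n ∸ 3) (2 * k ∸ 2) G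
  odd n n≥ with subst (_≤ n) (trans (+-comm (2 * k) 2) (cong (2 +_) 2k≡)) n≥
  ... | s≤s (s≤s (s≤s (s≤s 2p≤m-1))) =
    lk-top⇔bdC p 3 _ (s≤s z≤n) (s≤s 2p≤m-1) (sym (interval-3 _)) J≡ (+-comm 3 _) d≡ e≡
    where
    J≡ : Jof (suc (2 * k)) ≡ replicate p 2 ++ 4 ∷ []
    J≡ = trans (cong (Jof ∘ suc) (*-comm 2 k)) (Jof-pairs p 1 (s≤s (s≤s z≤n)))
    d≡ : suc (2 * k) ≡ 2 * p + 3
    d≡ = trans (cong suc 2k≡) (+-comm 3 (2 * p))
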